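{- Let $\alpha=[\alpha_1,\dots,\alpha_m]$ be a composition of $n$ and let $\mathcal{V}_\alpha$ be the $H_n(0)$-module with basis the standard immaculate tableaux of shape $\alpha$ and action $\pi_i(T)=0$ if $i$ and $i+1$ are both in the first column of $T$; $\pi_i(T)=T$ if $i$ is in a row weakly below the row containing $i+1$; and $\pi_i(T)=s_i(T)$ otherwise, where $s_i(T)$ is obtained from $T$ by swapping the entries $i$ and $i+1$. Then $\mathcal{V}_\alpha$ is cyclically generated by the super-standard tableau $\hat{S}_\alpha$, the standard immaculate tableau of shape $\alpha$ whose first row contains $1,\dots,\alpha_1$, second row contains $\alpha_1+1,\dots,\alpha_1+\alpha_2$, and so on.
   Context: A composition of $n$ is a tuple of positive integers summing to $n$; its diagram has left-justified rows of lengths $\alpha_1,\dots,\alpha_m$ from top to bottom. A standard immaculate tableau of shape $\alpha$ is a filling of the diagram of $\alpha$ with $1,\dots,n$, each used once, such that rows increase left to right and the first column increases top to bottom. The $0$-Hecke algebra $H_n(0)$ is generated by $\pi_1,\dots,\pi_{n-1}$ with relations $\pi_i^2=\pi_i$, $\pi_i\pi_{i+1}\pi_i=\pi_{i+1}\pi_i\pi_{i+1}$, $\pi_i\pi_j=\pi_j\pi_i$ for $|i-j|>1$. (Equivalently, $\mathcal{V}_\alpha$ is the quotient of the module spanned by words with $\alpha_j$ letters $j$, with $\pi_i$ fixing $w$ if $w_i\ge w_{i+1}$ and swapping $w_i,w_{i+1}$ otherwise, by the span of words that are not $\mathcal{Y}$-words, i.e. words where some first occurrence of $j+1$ precedes the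 first occurrence of $j$; a $\mathcal{Y}$-word $w$ corresponds to the tableau having $j$ in row $w_j$.) -}

module Defs where

open import Data.Nat using (ℕ; zero; suc; _+_; _<_; _≤_; _≡ᵇ_; _≤ᵇ_)
open import Data.Bool using (Bool; true; false; _∨_; _∧_; if_then_else_)
open import Data.List using (List; []; _∷_; map; length; concat; upTo)
open import Data.Nat.ListAction using (sum)
open import Data.List.Relation.Unary.All using (All)
open import Data.List.Relation.Unary.Linked using (Linked)
open import Data.List.Relation.Binary.Permutation.Propositional using (_↭_)
open import Data.Maybe using (Maybe; just; nothing)
open import Data.Product using (_×_)
open import Relation.Binary.PropositionalEquality using (_≡_)

IsComposition : List ℕ → Set
IsComposition α = All (λ a → 0 < a) α

-- A filling of a diagram: list of rows (top to bottom), each a list of entries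
-- (left to right).
Filling : Set
Filling = List (List ℕ)

firstCol : Filling → List ℕ
firstCol [] = []
firstCol ([] ∷ rs) = firstCol rs
firstCol ((x ∷ _) ∷ rs) = x ∷ firstCol rs

record IsSIT (α : List ℕ) (T : Filling) : Set where
  field
    shape    : map length T ≡ α
    entries  : concat T ↭ map suc (upTo (sum α))
    rowsInc  : All (Linked _<_) T
    colInc   : Linked _<_ (firstCol T)

memb : ℕ → List ℕ → Bool
memb x [] = false
memb x (y ∷ ys) = (x ≡ᵇ y) ∨ memb x ys

-- index (from 0, top to bottom) of the row containing x
rowOf : ℕ → Filling → ℕ
rowOf x [] = 0
rowOf x (r ∷ rs) = if memb x r then 0 else suc (rowOf x rs)

swapE : ℕ → ℕ → ℕ
swapE i x = if x ≡ᵇ i then suc i else (if x ≡ᵇ suc i then i else x)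

sᵢ : ℕ → Filling → Filling
sᵢ i T = map (map (swapE i)) T

-- Action of π_i on a basis tableau; nothing represents the zero vector.
πT : ℕ → Filling → Maybe Filling
πT i T =
  if memb i (firstCol T) ∧ memb (suc i) (firstCol T) then nothing
  else (if rowOf (suc i) T ≤ᵇ rowOf i T then just T else just (sᵢ i T))

π : ℕ → Maybe Filling → Maybe Filling
π i nothing = nothing
π i (just T) = πT i T

-- π_{i₁} π_{i₂} ⋯ π_{i_k} applied to x (rightmost acts first)
act : List ℕ → Maybe Filling → Maybe Filling
act [] x = x
act (i ∷ w) x = π i (act w x)

ValidWord : ℕ → List ℕ → Set
ValidWord n w = All (λ i → 1 ≤ i × suc i ≤ n) w

block : ℕ → ℕ → List ℕ
block k zero = []
block k (suc a) = k ∷ block (suc k) a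

superStdFrom : ℕ → List ℕ → Filling
superStdFrom k [] = []
superStdFrom k (a ∷ α) = block k a ∷ superStdFrom (k + a) α

superStd : List ℕ → Filling
superStd α = superStdFrom 1 α

-- Read a standard immaculate tableau T through its Y-word, the row index of 1, …, n.
-- If the word is weakly increasing, T is the super-standard tableau. Otherwise there is a
-- descent i, with i + 1 in a strictly higher row than i. Then i and i + 1 share neither a
-- row nor the first column, so s_i T is again standard immaculate and π_i (s_i T) = T.
-- Swapping a descent strictly lowers a weighted sum of the Y-word, so repeating this
-- reaches the super-standard tableau; the swaps, read backwards, form the required word.

module Submission where

open import Defs
open import Data.Nat using (ℕ; zero; suc; _+_; _*_; _<_; _≤_; z≤n; s≤s; s≤s⁻¹)
open import Data.Nat.Properties
open import Data.Nat.Induction using (<-wellFounded)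
open import Data.Bool using (_∨_)
open import Data.List using (List; []; _∷_; _++_; map; length; concat; upTo; applyUpTo)
open import Data.List.Properties using (map-upTo; map-++; map-∘; map-cong; map-cong-local; map-id-local; length-map; length-++; concat-map; ∷-injective)
open import Data.Nat.ListAction using (sum)
open import Data.List.Membership.Propositional using (_∈_; _∉_)
open import Data.List.Membership.Propositional.Properties using (∈-map⁺; ∈-map⁻; ∈-concat⁺′; ∈-++⁺ʳ)
open import Data.List.Membership.DecPropositional _≟_ using (_∈?_)
open import Data.List.Relation.Unary.All as All using (All; []; _∷_)
import Data.List.Relation.Unary.All.Properties as All⁺
open import Data.List.Relation.Unary.Any using (here; there)
open import Data.List.Relation.Unary.AllPairs as AllPairs using ([]; _∷_)
open import Data.List.Relation.Unary.Linked as Linked using (Linked; []; [-]; _∷_)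
open import Data.List.Relation.Unary.Linked.Properties using (Linked⇒All; Linked⇒AllPairs)
import Data.List.Relation.Unary.Linked.Properties as Linked⁺
open import Data.List.Relation.Unary.Unique.Propositional using (Unique)
open import Data.List.Relation.Binary.Permutation.Propositional using (_↭_; ↭-sym; ↭-swap; ↭-refl; ↭⇒↭ₛ; module PermutationReasoning)
open import Data.List.Relation.Binary.Permutation.Propositional.Properties using (map⁺; drop-∷; ++⁺ˡ; ∈-resp-↭)
import Data.List.Relation.Binary.Permutation.Setoid.Properties as ↭ₛ
open import Data.Maybe using (just)
open import Data.Product using (_×_; _,_; ∃; ∃₂; proj₁; proj₂; uncurry)
open import Data.Sum using (_⊎_; inj₁; inj₂)
open import Data.Empty using (⊥-elim)
open import Function using (_∘_; _⇔_; mk⇔; Equivalence)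
open import Algebra.Definitions using (Involutive)
open import Induction.WellFounded using (Acc; acc)
open import Relation.Nullary using (¬_; yes; no; does; _×-dec_)
open import Relation.Nullary.Decidable using (dec-true; dec-false; does-⇔)
open import Level using (0ℓ)
open import Relation.Binary.Core using (Rel)
open import Relation.Binary.Definitions using (Transitive)
open import Relation.Binary.PropositionalEquality using (_≡_; _≢_; refl; sym; trans; cong; cong₂; subst; subst₂; setoid; module ≡-Reasoning)
open import Data.Nat.Solver using (module +-*-Solver)

memb≡does : ∀ x L → memb x L ≡ does (x ∈? L)
memb≡does x [] = refl
memb≡does x (y ∷ L) = cong (does (x ≟ y) ∨_) (memb≡does x L)

rowOf-∈ : ∀ {x r} T → x ∈ r → rowOf x (r ∷ T) ≡ 0
rowOf-∈ {x} {r} T x∈r rewrite memb≡does x r | dec-true (x ∈? r) x∈r = refl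

rowOf-∉ : ∀ {x r} T → x ∉ r → rowOf x (r ∷ T) ≡ suc (rowOf x T)
rowOf-∉ {x} {r} T x∉r rewrite memb≡does x r | dec-false (x ∈? r) x∉r = refl

module _ (i : ℕ) where

  swapE-i : swapE i i ≡ suc i
  swapE-i rewrite dec-true (i ≟ i) refl = refl

  swapE-suc : swapE i (suc i) ≡ i
  swapE-suc rewrite dec-false (suc i ≟ i) 1+n≢n | dec-true (i ≟ i) refl = refl

  swapE-other : ∀ {x} → x ≢ i → x ≢ suc i → swapE i x ≡ x
  swapE-other {x} x≢i x≢1+i rewrite dec-false (x ≟ i) x≢i | dec-false (x ≟ suc i) x≢1+i = refl

  swapE-involutive : ∀ x → swapE i (swapE i x) ≡ x
  swapE-involutive x with x ≟ i | x ≟ suc i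
  ... | yes refl | _ rewrite swapE-i = swapE-suc
  ... | no _ | yes refl rewrite swapE-suc = swapE-i
  ... | no x≢i | no x≢1+i rewrite swapE-other x≢i x≢1+i = swapE-other x≢i x≢1+i

  swapE-monotone : ∀ {x y} → x < y → ¬ (x ≡ i × y ≡ suc i) → swapE i x < swapE i y
  swapE-monotone {x} {y} x<y ¬adjacent with x ≟ i | x ≟ suc i | y ≟ i | y ≟ suc i
  ... | yes refl | _ | yes refl | _ = ⊥-elim (<-irrefl refl x<y)
  ... | yes refl | _ | _ | yes refl = ⊥-elim (¬adjacent (refl , refl))
  ... | yes refl | _ | no y≢i | no y≢1+i rewrite swapE-i | swapE-other y≢i y≢1+i = ≤∧≢⇒< x<y (y≢1+i ∘ sym)
  ... | no _ | yes refl | yes refl | _ = ⊥-elim (<-asym x<y (n<1+n y))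
  ... | no _ | yes refl | _ | yes refl = ⊥-elim (<-irrefl refl x<y)
  ... | no _ | yes refl | no y≢i | no y≢1+i rewrite swapE-suc | swapE-other y≢i y≢1+i = <-trans (n<1+n i) x<y
  ... | no x≢i | no x≢1+i | yes refl | _ rewrite swapE-other x≢i x≢1+i | swapE-i = m<n⇒m<1+n x<y
  ... | no x≢i | no x≢1+i | _ | yes refl rewrite swapE-other x≢i x≢1+i | swapE-suc = ≤∧≢⇒< (s≤s⁻¹ x<y) x≢i
  ... | no x≢i | no x≢1+i | no y≢i | no y≢1+i rewrite swapE-other x≢i x≢1+i | swapE-other y≢i y≢1+i = x<y

  ∈-map-swapE : ∀ {x L} → x ∈ map (swapE i) L ⇔ swapE i x ∈ L
  ∈-map-swapE {x} {L} = mk⇔ to from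
    where
    to : x ∈ map (swapE i) L → swapE i x ∈ L
    to x∈ with ∈-map⁻ (swapE i) x∈
    ... | y , y∈L , refl = subst (_∈ L) (sym (swapE-involutive y)) y∈L
    from : swapE i x ∈ L → x ∈ map (swapE i) L
    from sx∈L = subst (_∈ map (swapE i) L) (swapE-involutive x) (∈-map⁺ (swapE i) sx∈L)

  map-swapE-increasing : ∀ {L} → Linked _<_ L → ¬ (i ∈ L × suc i ∈ L) → Linked _<_ (map (swapE i) L)
  map-swapE-increasing [] _ = []
  map-swapE-increasing [-] _ = [-]
  map-swapE-increasing (x<y ∷ y↗) ¬both =
    swapE-monotone x<y (λ { (refl , refl) → ¬both (here refl , there (here refl)) }) ∷
    map-swapE-increasing y↗ (λ { (p , q) → ¬both (there p , there q) })

  rowOf-sᵢ : ∀ x T → rowOf x (sᵢ i T) ≡ rowOf (swapE i x) T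
  rowOf-sᵢ x [] = refl
  rowOf-sᵢ x (r ∷ T)
    rewrite memb≡does x (map (swapE i) r) | memb≡does (swapE i x) r
          | does-⇔ ∈-map-swapE (x ∈? map (swapE i) r) (swapE i x ∈? r) | rowOf-sᵢ x T = refl

  firstCol-sᵢ : ∀ T → firstCol (sᵢ i T) ≡ map (swapE i) (firstCol T)
  firstCol-sᵢ [] = refl
  firstCol-sᵢ ([] ∷ T) = firstCol-sᵢ T
  firstCol-sᵢ ((x ∷ _) ∷ T) = cong (swapE i x ∷_) (firstCol-sᵢ T)

map-involutive : ∀ {A : Set} {f : A → A} → Involutive _≡_ f → Involutive _≡_ (map f)
map-involutive f-inv [] = refl
map-involutive f-inv (x ∷ xs) = cong₂ _∷_ (f-inv x) (map-involutive f-inv xs)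

sᵢ-involutive : ∀ i → Involutive _≡_ (sᵢ i)
sᵢ-involutive i = map-involutive (map-involutive (swapE-involutive i))

block-lowerBound : ∀ k N → All (k ≤_) (block k N)
block-lowerBound k zero = []
block-lowerBound k (suc N) = ≤-refl ∷ All.map <⇒≤ (block-lowerBound (suc k) N)

block-increasing : ∀ k N → Linked _<_ (block k N)
block-increasing k zero = []
block-increasing k (suc zero) = [-]
block-increasing k (suc (suc N)) = ≤-refl ∷ block-increasing (suc k) (suc N)

block-unique : ∀ k N → Unique (block k N)
block-unique k N = AllPairs.map <⇒≢ (Linked⇒AllPairs <-trans (block-increasing k N))

applyUpTo-block : ∀ k (f : ℕ → ℕ) n → (∀ x → f x ≡ k + x) → applyUpTo f n ≡ block k n
applyUpTo-block k f zero f≗k+ = refl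
applyUpTo-block k f (suc n) f≗k+ =
  cong₂ _∷_ (trans (f≗k+ 0) (+-identityʳ k))
            (applyUpTo-block (suc k) (f ∘ suc) n (λ x → trans (f≗k+ (suc x)) (+-suc k x)))

map-suc-upTo : ∀ n → map suc (upTo n) ≡ block 1 n
map-suc-upTo n = trans (map-upTo suc n) (applyUpTo-block 1 suc n (λ _ → refl))

map-swapE-block : ∀ {i} k N → suc (suc i) ≤ k → map (swapE i) (block k N) ≡ block k N
map-swapE-block {i} k N 2+i≤k = map-id-local (All.map fixed (block-lowerBound k N))
  where
  fixed : ∀ {x} → k ≤ x → swapE i x ≡ x
  fixed k≤x = swapE-other i (λ { refl → 1+n≰n (<⇒≤ (≤-trans 2+i≤k k≤x)) })
                            (λ { refl → 1+n≰n (≤-trans 2+i≤k k≤x) })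

block-split-swapE : ∀ {i} k N → k ≤ i → suc i < k + N →
  ∃₂ λ xs ys → block k N ≡ xs ++ i ∷ suc i ∷ ys × map (swapE i) (block k N) ≡ xs ++ suc i ∷ i ∷ ys
block-split-swapE {i} k zero k≤i i<k+N =
  ⊥-elim (<⇒≱ i<k+N (≤-trans (≤-reflexive (+-identityʳ k)) (m≤n⇒m≤1+n k≤i)))
block-split-swapE {i} k (suc N) k≤i i<k+N with k ≟ i
block-split-swapE k (suc zero) k≤i i<k+N | yes refl = ⊥-elim (<-irrefl (sym (+-comm k 1)) i<k+N)
block-split-swapE k (suc (suc N)) k≤i i<k+N | yes refl =
  [] , block (suc (suc k)) N , refl ,
  cong₂ _∷_ (swapE-i k) (cong₂ _∷_ (swapE-suc k) (map-swapE-block (suc (suc k)) N ≤-refl))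
... | no k≢i with block-split-swapE (suc k) N (≤∧≢⇒< k≤i k≢i) (subst (suc i <_) (+-suc k N) i<k+N)
...   | xs , ys , split , split-swapped =
  k ∷ xs , ys , cong (k ∷_) split ,
  cong₂ _∷_ (swapE-other i k≢i (λ { refl → 1+n≰n k≤i })) split-swapped

Linked-head : ∀ {A : Set} {R : Rel A 0ℓ} → Transitive R → ∀ {x xs} → Linked R (x ∷ xs) → All (R x) xs
Linked-head _ [-] = []
Linked-head trans (Rxy ∷ R↗) = Linked⇒All trans Rxy R↗

Linked-tail : ∀ {A : Set} {R : Rel A 0ℓ} {x xs} → Linked R (x ∷ xs) → Linked R xs
Linked-tail [-] = []
Linked-tail (_ ∷ R↗) = R↗

unique-++-disjoint : ∀ (xs : List ℕ) {ys x} → Unique (xs ++ ys) → x ∈ xs → x ∉ ys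
unique-++-disjoint (_ ∷ xs) (x≢ ∷ _) (here refl) x∈ys = All.lookup x≢ (∈-++⁺ʳ xs x∈ys) refl
unique-++-disjoint (_ ∷ xs) (_ ∷ u) (there x∈xs) = unique-++-disjoint xs u x∈xs

unique-++ʳ : ∀ (xs : List ℕ) {ys} → Unique (xs ++ ys) → Unique ys
unique-++ʳ [] u = u
unique-++ʳ (_ ∷ xs) (_ ∷ u) = unique-++ʳ xs u

firstCol⊆concat : ∀ {x} T → x ∈ firstCol T → x ∈ concat T
firstCol⊆concat ([] ∷ T) x∈ = firstCol⊆concat T x∈
firstCol⊆concat ((_ ∷ r) ∷ T) (here refl) = here refl
firstCol⊆concat ((_ ∷ r) ∷ T) (there x∈) = there (∈-++⁺ʳ r (firstCol⊆concat T x∈))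

module _ {i : ℕ} where

  descent-separates-rows : ∀ T → Unique (concat T) → rowOf (suc i) T < rowOf i T →
                           All (λ r → ¬ (i ∈ r × suc i ∈ r)) T
  descent-separates-rows [] _ ()
  descent-separates-rows (r ∷ T) u desc with i ∈? r
  ... | yes i∈r = ⊥-elim (n≮0 (subst (rowOf (suc i) (r ∷ T) <_) (rowOf-∈ T i∈r) desc))
  ... | no i∉r with suc i ∈? r
  ...   | yes 1+i∈r =
    (i∉r ∘ proj₁) ∷ All.tabulate λ r'∈T (_ , 1+i∈r') → unique-++-disjoint r u 1+i∈r (∈-concat⁺′ 1+i∈r' r'∈T)
  ...   | no 1+i∉r =
    (i∉r ∘ proj₁) ∷ descent-separates-rows T (unique-++ʳ r u)
                      (s≤s⁻¹ (subst₂ _<_ (rowOf-∉ T 1+i∉r) (rowOf-∉ T i∉r) desc))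

  descent-separates-firstCol : ∀ T → Unique (concat T) → Linked _<_ (firstCol T) → rowOf (suc i) T < rowOf i T →
                               ¬ (i ∈ firstCol T × suc i ∈ firstCol T)
  descent-separates-firstCol [] _ _ ()
  descent-separates-firstCol ([] ∷ T) u col desc = descent-separates-firstCol T u col (s≤s⁻¹ desc)
  descent-separates-firstCol ((x ∷ r) ∷ T) u col desc (i∈col , 1+i∈col) with i ∈? (x ∷ r)
  ... | yes i∈row = ⊥-elim (n≮0 (subst (rowOf (suc i) ((x ∷ r) ∷ T) <_) (rowOf-∈ T i∈row) desc))
  ... | no i∉row with i∈col | 1+i∈col
  ...   | here refl | _ = i∉row (here refl)
  ...   | there i∈col′ | here refl = <-asym (n<1+n i) (All.lookup (Linked-head <-trans col) i∈col′)
  ...   | there i∈col′ | there 1+i∈col′ =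
    descent-separates-firstCol T (unique-++ʳ (x ∷ r) u) (Linked-tail col)
      (s≤s⁻¹ (subst₂ _<_ (rowOf-∉ T 1+i∉row) (rowOf-∉ T i∉row) desc)) (i∈col′ , 1+i∈col′)
    where
    1+i∉row : suc i ∉ x ∷ r
    1+i∉row 1+i∈row = unique-++-disjoint (x ∷ r) u 1+i∈row (firstCol⊆concat T 1+i∈col′)

πT-ascent : ∀ {i T} → ¬ (i ∈ firstCol T × suc i ∈ firstCol T) → rowOf i T < rowOf (suc i) T →
            πT i T ≡ just (sᵢ i T)
πT-ascent {i} {T} ¬both asc
  rewrite memb≡does i (firstCol T) | memb≡does (suc i) (firstCol T)
        | dec-false (i ∈? firstCol T ×-dec suc i ∈? firstCol T) ¬both
        | dec-false (rowOf (suc i) T ≤? rowOf i T) (<⇒≱ asc) = refl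

module _ {α T} (sit : IsSIT α T) where
  open IsSIT sit

  entries-block : concat T ↭ block 1 (sum α)
  entries-block = subst (concat T ↭_) (map-suc-upTo (sum α)) entries

  entries-unique : Unique (concat T)
  entries-unique = ↭ₛ.Unique-resp-↭ (setoid ℕ) (↭⇒↭ₛ (↭-sym entries-block)) (block-unique 1 (sum α))

  module _ {i} (desc : rowOf (suc i) T < rowOf i T) where

    firstCol-separated : ¬ (i ∈ firstCol T × suc i ∈ firstCol T)
    firstCol-separated = descent-separates-firstCol T entries-unique colInc desc

    πT-sᵢ : πT i (sᵢ i T) ≡ just T
    πT-sᵢ = trans (πT-ascent ¬both ascent) (cong just (sᵢ-involutive i T))
      where
      from-swapped : ∀ {x} → x ∈ firstCol (sᵢ i T) → swapE i x ∈ firstCol T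
      from-swapped x∈ = Equivalence.to (∈-map-swapE i) (subst (_ ∈_) (firstCol-sᵢ i T) x∈)
      ¬both : ¬ (i ∈ firstCol (sᵢ i T) × suc i ∈ firstCol (sᵢ i T))
      ¬both (i∈ , 1+i∈) = firstCol-separated
        (subst (_∈ firstCol T) (swapE-suc i) (from-swapped 1+i∈) , subst (_∈ firstCol T) (swapE-i i) (from-swapped i∈))
      ascent : rowOf i (sᵢ i T) < rowOf (suc i) (sᵢ i T)
      ascent rewrite rowOf-sᵢ i i T | rowOf-sᵢ i (suc i) T | swapE-i i | swapE-suc i = desc

    module _ (1≤i : 1 ≤ i) (i<n : suc i < 1 + sum α) where

      sᵢ-entries : concat (sᵢ i T) ↭ map suc (upTo (sum α))
      sᵢ-entries with block-split-swapE 1 (sum α) 1≤i i<n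
      ... | xs , ys , split , split-swapped = begin
        concat (sᵢ i T)                 ≡⟨ concat-map T ⟩
        map (swapE i) (concat T)        ↭⟨ map⁺ (swapE i) entries-block ⟩
        map (swapE i) (block 1 (sum α)) ≡⟨ split-swapped ⟩
        xs ++ suc i ∷ i ∷ ys            ↭⟨ ++⁺ˡ xs (↭-swap (suc i) i ↭-refl) ⟩
        xs ++ i ∷ suc i ∷ ys            ≡⟨ sym split ⟩
        block 1 (sum α)                 ≡⟨ sym (map-suc-upTo (sum α)) ⟩
        map suc (upTo (sum α))          ∎
        where open PermutationReasoning

      sᵢ-isSIT : IsSIT α (sᵢ i T)
      sᵢ-isSIT = record
        { shape = trans (trans (sym (map-∘ T)) (map-cong (length-map (swapE i)) T)) shape
        ; entries = sᵢ-entries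
        ; rowsInc = All⁺.map⁺ (All.zipWith (uncurry (map-swapE-increasing i))
                      (rowsInc , descent-separates-rows T entries-unique desc))
        ; colInc = subst (Linked _<_) (sym (firstCol-sᵢ i T)) (map-swapE-increasing i colInc firstCol-separated)
        }

-- The paper's Y-word, restricted to the entries k, …, k + N - 1 (rows are counted from 0).
rowWord : ℕ → ℕ → Filling → List ℕ
rowWord k N T = map (λ j → rowOf j T) (block k N)

-- The entries of a list of length n get weights n, n - 1, …, 1, so replacing an adjacent
-- descent a, b (with b < a) by b, a lowers the sum by a - b.
weightedSum : List ℕ → ℕ
weightedSum [] = 0
weightedSum (x ∷ xs) = suc (length xs) * x + weightedSum xs

weightedSum-swap : ∀ xs {a b} ys → weightedSum (xs ++ b ∷ a ∷ ys) + a ≡ weightedSum (xs ++ a ∷ b ∷ ys) + b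
weightedSum-swap [] {a} {b} ys =
  solve 4 (λ l a b w → (con 2 :+ l) :* b :+ ((con 1 :+ l) :* a :+ w) :+ a
                     := (con 2 :+ l) :* a :+ ((con 1 :+ l) :* b :+ w) :+ b)
          refl (length ys) a b (weightedSum ys)
  where open +-*-Solver
weightedSum-swap (x ∷ xs) {a} {b} ys = begin
  suc (length (xs ++ b ∷ a ∷ ys)) * x + weightedSum (xs ++ b ∷ a ∷ ys) + a
    ≡⟨ +-assoc (suc (length (xs ++ b ∷ a ∷ ys)) * x) _ a ⟩
  suc (length (xs ++ b ∷ a ∷ ys)) * x + (weightedSum (xs ++ b ∷ a ∷ ys) + a)
    ≡⟨ cong₂ (λ l w → suc l * x + w) (trans (length-++ xs) (sym (length-++ xs))) (weightedSum-swap xs ys) ⟩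
  suc (length (xs ++ a ∷ b ∷ ys)) * x + (weightedSum (xs ++ a ∷ b ∷ ys) + b)
    ≡⟨ +-assoc (suc (length (xs ++ a ∷ b ∷ ys)) * x) _ b ⟨
  suc (length (xs ++ a ∷ b ∷ ys)) * x + weightedSum (xs ++ a ∷ b ∷ ys) + b ∎
  where open ≡-Reasoning

weightedSum-descent : ∀ xs {a b} ys → b < a → weightedSum (xs ++ b ∷ a ∷ ys) < weightedSum (xs ++ a ∷ b ∷ ys)
weightedSum-descent xs {a} {b} ys b<a = +-cancelʳ-< a _ _
  (subst (_< weightedSum (xs ++ a ∷ b ∷ ys) + a) (sym (weightedSum-swap xs ys)) (+-monoʳ-< _ b<a))

rowWord-sᵢ-decreases : ∀ {i} k N T → k ≤ i → suc i < k + N → rowOf (suc i) T < rowOf i T →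
                       weightedSum (rowWord k N (sᵢ i T)) < weightedSum (rowWord k N T)
rowWord-sᵢ-decreases {i} k N T k≤i i<k+N desc with block-split-swapE k N k≤i i<k+N
... | xs , ys , split , split-swapped =
  subst₂ (λ u v → weightedSum u < weightedSum v) (sym swapped-word) (sym word)
    (weightedSum-descent (map h xs) (map h ys) desc)
  where
  h : ℕ → ℕ
  h j = rowOf j T
  word : rowWord k N T ≡ map h xs ++ h i ∷ h (suc i) ∷ map h ys
  word = trans (cong (map h) split) (map-++ h xs _)
  swapped-word : rowWord k N (sᵢ i T) ≡ map h xs ++ h (suc i) ∷ h i ∷ map h ys
  swapped-word = begin
    rowWord k N (sᵢ i T)                   ≡⟨ map-cong (λ j → rowOf-sᵢ i j T) (block k N) ⟩
    map (h ∘ swapE i) (block k N)          ≡⟨ map-∘ (block k N) ⟩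
    map h (map (swapE i) (block k N))      ≡⟨ cong (map h) split-swapped ⟩
    map h (xs ++ suc i ∷ i ∷ ys)           ≡⟨ map-++ h xs _ ⟩
    map h xs ++ h (suc i) ∷ h i ∷ map h ys ∎
    where open ≡-Reasoning

ascending-or-descent : ∀ (f : ℕ → ℕ) k N →
  Linked _≤_ (map f (block k N)) ⊎ ∃ λ i → k ≤ i × suc i < k + N × f (suc i) < f i
ascending-or-descent f k zero = inj₁ []
ascending-or-descent f k (suc zero) = inj₁ [-]
ascending-or-descent f k (suc (suc N)) with ascending-or-descent f (suc k) (suc N)
... | inj₂ (i , k<i , i<k+N , desc) = inj₂ (i , <⇒≤ k<i , subst (suc i <_) (sym (+-suc k (suc N))) i<k+N , desc)
... | inj₁ asc with f k ≤? f (suc k)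
...   | yes fk≤ = inj₁ (fk≤ ∷ asc)
...   | no fk≰ =
  inj₂ (k , ≤-refl , subst (_≤ k + suc (suc N)) (+-comm k 2) (+-monoʳ-≤ k (s≤s (s≤s z≤n))) , ≰⇒> fk≰)

rowOf-dropHead : ∀ {j x} r T → j ≢ x → rowOf j ((x ∷ r) ∷ T) ≡ rowOf j (r ∷ T)
rowOf-dropHead {j} {x} r T j≢x rewrite dec-false (j ≟ x) j≢x = refl

-- The word ascends from k to x, which lies in row 0; so k lies in the first row, whose least entry is x.
head-is-least : ∀ {k N x r} T → x ∈ block k N → Linked _<_ (x ∷ r) →
                Linked _≤_ (rowWord k N ((x ∷ r) ∷ T)) → x ≡ k
head-is-least {N = suc N} T (here refl) _ _ = refl
head-is-least {k} {suc N} {x} {r} T (there x∈) x↗ asc with k ∈? (x ∷ r)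
... | yes (here k≡x) = sym k≡x
... | yes (there k∈r) = ⊥-elim (<-asym (All.lookup (Linked-head <-trans x↗) k∈r)
                                       (All.lookup (block-lowerBound (suc k) N) x∈))
... | no k∉row = ⊥-elim (n≮0 (subst₂ _≤_ (rowOf-∉ T k∉row) (rowOf-∈ {r = x ∷ r} T (here refl))
                                   (All.lookup (Linked-head ≤-trans asc) (∈-map⁺ _ x∈))))

ascending⇒superStdFrom : ∀ k a α' T → map length T ≡ a ∷ α' → concat T ↭ block k (a + sum α') →
  All (Linked _<_) T → Linked _≤_ (rowWord k (a + sum α') T) → T ≡ superStdFrom k (a ∷ α')
ascending⇒superStdFrom k zero [] ([] ∷ []) _ _ _ _ = refl
ascending⇒superStdFrom k zero (b ∷ α') ([] ∷ T) shape perm (_ ∷ rows) asc rewrite +-identityʳ k =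
  cong ([] ∷_) (ascending⇒superStdFrom k b α' T (proj₂ (∷-injective shape)) perm rows
                  (Linked⁺.map⁺ (Linked.map s≤s⁻¹ (Linked⁺.map⁻ asc))))
ascending⇒superStdFrom k (suc a) α' ((x ∷ r) ∷ T) shape perm (x↗ ∷ rows) asc
  with refl ← head-is-least T (∈-resp-↭ perm (here refl)) x↗ asc
  = cong₂ _∷_ (cong (x ∷_) (proj₁ (∷-injective rest)))
              (trans (proj₂ (∷-injective rest)) (cong (λ m → superStdFrom m α') (sym (+-suc x a))))
  where
  rest : r ∷ T ≡ superStdFrom (suc x) (a ∷ α')
  rest = ascending⇒superStdFrom (suc x) a α' (r ∷ T)
    (cong₂ _∷_ (suc-injective (proj₁ (∷-injective shape))) (proj₂ (∷-injective shape)))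
    (drop-∷ perm) (Linked-tail x↗ ∷ rows)
    (subst (Linked _≤_)
           (map-cong-local (All.map (λ x<j → rowOf-dropHead r T (>⇒≢ x<j)) (block-lowerBound (suc x) _)))
           (Linked-tail asc))

ascending⇒superStd : ∀ {α T} → IsSIT α T → Linked _≤_ (rowWord 1 (sum α) T) → T ≡ superStd α
ascending⇒superStd {[]} {[]} _ _ = refl
ascending⇒superStd {[]} {_ ∷ _} sit _ with () ← IsSIT.shape sit
ascending⇒superStd {a ∷ α'} {T} sit asc = ascending⇒superStdFrom 1 a α' T shape (entries-block sit) rowsInc asc
  where open IsSIT sit

Reachable : List ℕ → Filling → Set
Reachable α T = ∃ λ (w : List ℕ) → ValidWord (sum α) w × act w (just (superStd α)) ≡ just T

reachable : ∀ α T → IsSIT α T → Acc _<_ (weightedSum (rowWord 1 (sum α) T)) → Reachable α T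
reachable α T sit (acc smaller) with ascending-or-descent (λ j → rowOf j T) 1 (sum α)
... | inj₁ asc = [] , [] , cong just (sym (ascending⇒superStd sit asc))
... | inj₂ (i , 1≤i , i<n , desc)
  with w , valid , w·Ŝ≡sᵢT ← reachable α (sᵢ i T) (sᵢ-isSIT sit desc 1≤i i<n)
                               (smaller (rowWord-sᵢ-decreases 1 (sum α) T 1≤i i<n desc))
  = i ∷ w , (1≤i , s≤s⁻¹ i<n) ∷ valid , trans (cong (π i) w·Ŝ≡sᵢT) (πT-sᵢ sit desc)

lemma3p10 : (α : List ℕ) → IsComposition α → (T : Filling) → IsSIT α T →
    ∃ λ (w : List ℕ) → ValidWord (sum α) w × act w (just (superStd α)) ≡ just T
lemma3p10 α _ T sit = reachable α T sit (<-wellFounded _)
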